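{- Let $n\ge3$ and let $\lambda$ be a partition with $\lambda_1\le n-3$, with at most $n-1$ positive parts and each positive integer occurring at most twice. Then $$\mathfrak C^{n}((n-1,n-2)\oplus\lambda)+q^{n}\,\mathfrak C^{n-1}((n-2)\oplus\lambda)=[3]_q\,\mathfrak C^{n-1}(\lambda).$$
   Context: For $k\ge1$: grid with $2k$ rows numbered $1,\dots,2k$ from top to bottom and $k$ columns numbered $1,\dots,k$ from left to right; box $(i,j)$ is in row $i$, column $j$. For a partition $\lambda$ (with $\lambda_i=0$ beyond its last part), a Dellac configuration of size $k$ with boundaries $\lambda$ and $\delta_{k-1}=(k-1,\dots,1)$ is a set of $2k$ boxes ("dots") such that each row contains exactly one dot, each column contains exactly two dots, no dot lies in a box $(i,j)$ with $j\le\lambda_i$ (any row $i$), and no dot lies in a box $(i,j)$ with $k+2\le i\le 2k$ and $j\ge 2k+2-i$. An inversion is a pair of dots one of which lies strictly above and strictly to the left of the other. $\mathfrak C^k(\lambda)=\sum_C q^{\mathrm{inv}(C)}$ over all such configurations. For partitions $\lambda,\mu$, $\lambda\oplus\mu=(\lambda_1,\dots,\lambda_l,\mu_1,\dots,\mu_{l'})$ is the concatenation. $[3]_q=1+q+q^2$. -}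

module Defs where

open import Data.Nat using (ℕ; zero; suc; _+_; _*_; _∸_; _≤_; _≡ᵇ_; _<ᵇ_)
open import Data.Bool using (Bool; true; false; _∧_; _∨_; not; if_then_else_)
open import Data.List using (List; []; _∷_; map; filter; length; concatMap; upTo; foldr; replicate; _++_)
open import Data.List.Relation.Unary.All using (All)
open import Data.List.Relation.Unary.Linked using (Linked)
open import Relation.Binary.PropositionalEquality using (_≡_)
open import Relation.Nullary.Decidable using (Dec)
open import Data.Nat using (_≟_; _≥_)

record IsPartition (λs : List ℕ) : Set where
  field
    positive   : All (λ x → 1 ≤ x) λs
    decreasing : Linked _≥_ λs

-- λ_i with 1-indexing, 0 beyond the last part (and for i = 0).
part : List ℕ → ℕ → ℕ
part []       _             = 0
part (x ∷ xs) zero          = 0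
part (x ∷ xs) (suc zero)    = x
part (x ∷ xs) (suc (suc i)) = part xs (suc i)

mult : ℕ → List ℕ → ℕ
mult m xs = length (filter (λ x → m ≟ x) xs)

-- Polynomials in q with ℕ coefficients, as coefficient lists
-- (constant term first).  Equality of polynomials = equality of all
-- coefficients (trailing zeros irrelevant).

Poly : Set
Poly = List ℕ

coeff : Poly → ℕ → ℕ
coeff []       _       = 0
coeff (a ∷ p)  zero    = a
coeff (a ∷ p)  (suc d) = coeff p d

_⊕_ : Poly → Poly → Poly
[]      ⊕ q       = q
(a ∷ p) ⊕ []      = a ∷ p
(a ∷ p) ⊕ (b ∷ q) = (a + b) ∷ (p ⊕ q)

shift : ℕ → Poly → Poly
shift d p = replicate d 0 ++ p

scale : ℕ → Poly → Poly
scale c p = map (c *_) p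

_⊗_ : Poly → Poly → Poly
[]      ⊗ q = []
(a ∷ p) ⊗ q = scale a q ⊕ shift 1 (p ⊗ q)

monomial : ℕ → Poly
monomial d = shift d (1 ∷ [])

_≈ₚ_ : Poly → Poly → Set
p ≈ₚ q = ∀ d → coeff p d ≡ coeff q d

q3 : Poly
q3 = 1 ∷ 1 ∷ 1 ∷ []

-- Dellac configurations of size k with boundaries λ and δ_{k-1}.
-- A set of 2k dots with exactly one dot per row is encoded as the word
-- w = (c_1, …, c_{2k}) where c_i ∈ {1,…,k} is the column of the dot in
-- row i (rows numbered 1..2k from top to bottom).

range : ℕ → List ℕ
range k = map suc (upTo k)

words : ℕ → List ℕ → List (List ℕ)
words zero    xs = [] ∷ []
words (suc m) xs = concatMap (λ x → map (x ∷_) (words m xs)) xs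

colCount : ℕ → List ℕ → ℕ
colCount j w = length (filter (λ c → j ≟ c) w)

filterB : {A : Set} → (A → Bool) → List A → List A
filterB p []       = []
filterB p (x ∷ xs) = if p x then x ∷ filterB p xs else filterB p xs

allB : {A : Set} → (A → Bool) → List A → Bool
allB p []       = true
allB p (x ∷ xs) = p x ∧ allB p xs

columnsOK : ℕ → List ℕ → Bool
columnsOK k w = allB (λ j → colCount j w ≡ᵇ 2) (range k)

rowsOK : ℕ → List ℕ → ℕ → List ℕ → Bool
rowsOK k λs i []       = true
rowsOK k λs i (c ∷ w)  =
  (part λs i <ᵇ c)
  ∧ (not ((suc k) <ᵇ i) ∨ (c + i <ᵇ (2 * k + 2)))
  ∧ rowsOK k λs (suc i) w

isDellac : ℕ → List ℕ → List ℕ → Bool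
isDellac k λs w = columnsOK k w ∧ rowsOK k λs 1 w

-- inversions: pairs of dots, one strictly above and strictly left of the other
inv : List ℕ → ℕ
inv []      = 0
inv (c ∷ w) = length (filterB (λ c' → c <ᵇ c') w) + inv w

frakC : ℕ → List ℕ → Poly
frakC k λs =
  foldr (λ w p → monomial (inv w) ⊕ p) []
        (filterB (isDellac k λs) (words (2 * k) (range k)))

module Submission where

-- Both sides are inversion generating functions of Dellac configurations, and the identity comes from
-- a weight-preserving bijection. Read the right-hand side as three copies (tags t = 0, 1, 2) of the
-- configurations C of size k = n - 1 with boundary λ, weighted q^(t + inv C); C has two dots in its last
-- column k. Tag 0 adds a new column n with its two dots in two new top rows. Tags 1 and 2 put dots
-- n, k in the two new top rows and move the first, resp. second, dot of column k to column n; this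
-- creates exactly t new inversions, and every configuration of size n with boundary (n-1, n-2) ⊕ λ
-- arises exactly once from tags 0, 1, 2. The one exception is tag 2 when the second dot of column k lies
-- in row k + 1, below the staircase for column n: that dot is moved to the top row instead, which gives
-- the configurations of size n - 1 with boundary (n-2) ⊕ λ, each with n - 2 inversions fewer.

open import Defs
open import Data.Bool using (Bool; true; false; T; not; if_then_else_)
open import Data.Bool.Properties using (T-∧; T-∨)
open import Data.List using (List; []; _∷_; _++_; length; map; foldr; filter; take; drop; concatMap; cartesianProductWith)
open import Data.List.Properties
  using (map-∘; map-id-local; ++-assoc; length-++; length-take; take++drop≡id;
         filter-accept; filter-reject; filter-++; filter-none; filter-all)
open import Data.List.Membership.Propositional using (_∈_)
open import Data.List.Membership.Propositional.Properties
  using (∈-map⁺; ∈-map⁻; ∈-++⁺ˡ; ∈-++⁺ʳ; ∈-++⁻; ∈-filter⁺; ∈-filter⁻; ∈-upTo⁺; ∈-upTo⁻;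
         ∈-cartesianProductWith⁺; ∈-cartesianProductWith⁻)
open import Data.List.Membership.Propositional.Properties.WithK using (unique∧set⇒bag)
open import Data.List.Relation.Unary.All using (All; []; _∷_; tabulate)
import Data.List.Relation.Unary.All as All
import Data.List.Relation.Unary.All.Properties as All
open import Data.List.Relation.Unary.AllPairs using ([]; _∷_)
open import Data.List.Relation.Unary.Any using (here)
open import Data.List.Relation.Unary.Linked using (Linked; []; _∷_)
open import Data.List.Relation.Unary.Unique.Propositional using (Unique)
import Data.List.Relation.Unary.Unique.Propositional.Properties as Unique
open import Data.List.Relation.Binary.BagAndSetEquality using (∼bag⇒↭)
open import Data.List.Relation.Binary.Disjoint.Propositional using (Disjoint)
open import Data.List.Relation.Binary.Permutation.Propositional using (_↭_; refl; prep; swap; trans; ↭-sym)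
open import Data.List.Relation.Binary.Permutation.Propositional.Properties
  using (filter-↭; ↭-length; All-resp-↭) renaming (shift to ↭-shift)
open import Data.Nat using (ℕ; zero; suc; _+_; _*_; _∸_; _≤_; _<_; _≥_; z≤n; s≤s; _≟_; _≡ᵇ_; _<ᵇ_)
open import Data.Nat.Properties
  using (suc-injective; +-identityʳ; +-comm; +-assoc; +-suc; +-mono-≤; +-cancelˡ-<;
         ≤-refl; ≤-trans; ≤-reflexive; ≤-antisym; ≤-pred; <⇒≤; <⇒≢; <-≤-trans; ≤∧≢⇒<; ≮⇒≥; ≤⇒≯;
         m≤m+n; m≤n+m; m≤n⇒m≤1+n; m≤n⇒m<n∨m≡n; m≤n⇒∃[o]m+o≡n; m≤n⇒m⊓n≡m; ≡ᵇ⇒≡; ≡⇒≡ᵇ; <ᵇ⇒<; <⇒<ᵇ)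
open import Data.Nat.Solver using (module +-*-Solver)
open import Data.Product using (_×_; _,_; ∃; proj₁; proj₂)
open import Data.Sum using (_⊎_; inj₁; inj₂)
import Data.Sum as Sum
open import Data.Unit using (tt)
open import Function using (_∘_; _⇔_; mk⇔; Equivalence)
open import Relation.Binary using (Setoid; IsEquivalence)
open import Relation.Binary.PropositionalEquality as ≡ using (_≡_; _≢_; cong; cong₂; subst; subst₂)
import Relation.Binary.Reasoning.Setoid as SetoidReasoning
open import Relation.Nullary using (¬_; contradiction)
open import Relation.Nullary.Decidable using (T?; yes; no)

-- Polynomials

infix 4 _≋_

-- _≈ₚ_ wrapped in a record, so that the two polynomials can be inferred from the type.
record _≋_ (p r : Poly) : Set where
  constructor mk≋
  field coeff-≡ : p ≈ₚ r

open _≋_ public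

≋-isEquivalence : IsEquivalence _≋_
≋-isEquivalence = record
  { refl  = mk≋ λ d → ≡.refl
  ; sym   = λ (mk≋ e) → mk≋ λ d → ≡.sym (e d)
  ; trans = λ (mk≋ e) (mk≋ e′) → mk≋ λ d → ≡.trans (e d) (e′ d)
  }

≋-setoid : Setoid _ _
≋-setoid = record { isEquivalence = ≋-isEquivalence }

open IsEquivalence ≋-isEquivalence public
  using () renaming (refl to ≋-refl; sym to ≋-sym; trans to ≋-trans; reflexive to ≡⇒≋)

coeff-⊕ : ∀ p r d → coeff (p ⊕ r) d ≡ coeff p d + coeff r d
coeff-⊕ []      r       d       = ≡.refl
coeff-⊕ (a ∷ p) []      d       = ≡.sym (+-identityʳ _)
coeff-⊕ (a ∷ p) (b ∷ r) zero     = ≡.refl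
coeff-⊕ (a ∷ p) (b ∷ r) (suc d)   = coeff-⊕ p r d

⊕-cong : ∀ {p p′ r r′} → p ≋ p′ → r ≋ r′ → p ⊕ r ≋ p′ ⊕ r′
⊕-cong {p} {p′} {r} {r′} (mk≋ e) (mk≋ e′) = mk≋ λ d → begin
  coeff (p ⊕ r) d          ≡⟨ coeff-⊕ p r d ⟩
  coeff p d + coeff r d    ≡⟨ cong₂ _+_ (e d) (e′ d) ⟩
  coeff p′ d + coeff r′ d  ≡⟨ coeff-⊕ p′ r′ d ⟨
  coeff (p′ ⊕ r′) d        ∎
  where open ≡.≡-Reasoning

⊕-comm : ∀ p r → p ⊕ r ≋ r ⊕ p
⊕-comm p r = mk≋ λ d → begin
  coeff (p ⊕ r) d        ≡⟨ coeff-⊕ p r d ⟩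
  coeff p d + coeff r d  ≡⟨ +-comm (coeff p d) _ ⟩
  coeff r d + coeff p d  ≡⟨ coeff-⊕ r p d ⟨
  coeff (r ⊕ p) d        ∎
  where open ≡.≡-Reasoning

⊕-assoc : ∀ p r s → (p ⊕ r) ⊕ s ≋ p ⊕ (r ⊕ s)
⊕-assoc p r s = mk≋ λ d → begin
  coeff ((p ⊕ r) ⊕ s) d                ≡⟨ coeff-⊕ (p ⊕ r) s d ⟩
  coeff (p ⊕ r) d + coeff s d          ≡⟨ cong (_+ coeff s d) (coeff-⊕ p r d) ⟩
  coeff p d + coeff r d + coeff s d    ≡⟨ +-assoc (coeff p d) _ _ ⟩
  coeff p d + (coeff r d + coeff s d)  ≡⟨ cong (coeff p d +_) (coeff-⊕ r s d) ⟨
  coeff p d + coeff (r ⊕ s) d          ≡⟨ coeff-⊕ p (r ⊕ s) d ⟨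
  coeff (p ⊕ (r ⊕ s)) d                ∎
  where open ≡.≡-Reasoning

⊕-identityʳ : ∀ p → p ⊕ [] ≋ p
⊕-identityʳ p = mk≋ λ d → ≡.trans (coeff-⊕ p [] d) (+-identityʳ _)

shift-cong : ∀ s {p r} → p ≋ r → shift s p ≋ shift s r
shift-cong s (mk≋ e) = mk≋ (go s)
  where
  go : ∀ s → shift s _ ≈ₚ shift s _
  go zero    d       = e d
  go (suc s) zero    = ≡.refl
  go (suc s) (suc d) = go s d

shift-⊕ : ∀ s p r → shift s (p ⊕ r) ≋ shift s p ⊕ shift s r
shift-⊕ s p r = mk≋ (go s)
  where
  go : ∀ s → shift s (p ⊕ r) ≈ₚ (shift s p ⊕ shift s r)
  go zero    d       = ≡.refl
  go (suc s) zero    = ≡.refl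
  go (suc s) (suc d) = go s d

shift-[] : ∀ s → shift s [] ≋ []
shift-[] s = mk≋ (go s)
  where
  go : ∀ s → shift s [] ≈ₚ []
  go zero    d       = ≡.refl
  go (suc s) zero    = ≡.refl
  go (suc s) (suc d) = go s d

shift-monomial : ∀ s a → shift s (monomial a) ≋ monomial (s + a)
shift-monomial s a = mk≋ (go s)
  where
  go : ∀ s → shift s (monomial a) ≈ₚ monomial (s + a)
  go zero    d       = ≡.refl
  go (suc s) zero    = ≡.refl
  go (suc s) (suc d) = go s d

shift-shift : ∀ s t p → shift s (shift t p) ≋ shift (s + t) p
shift-shift s t p = mk≋ (go s)
  where
  go : ∀ s → shift s (shift t p) ≈ₚ shift (s + t) p
  go zero    d       = ≡.refl
  go (suc s) zero    = ≡.refl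
  go (suc s) (suc d) = go s d

scale-1 : ∀ p → scale 1 p ≋ p
scale-1 p = mk≋ (go p)
  where
  go : ∀ p → scale 1 p ≈ₚ p
  go []      d       = ≡.refl
  go (a ∷ p) zero    = +-identityʳ a
  go (a ∷ p) (suc d) = go p d

q3-⊗ : ∀ p → q3 ⊗ p ≋ p ⊕ (shift 1 p ⊕ shift 2 p)
q3-⊗ p = begin
  scale 1 p ⊕ shift 1 (scale 1 p ⊕ shift 1 (scale 1 p ⊕ shift 1 []))
    ≈⟨ ⊕-cong (scale-1 p) (shift-cong 1 (⊕-cong (scale-1 p) (shift-cong 1 q1⊗p))) ⟩
  p ⊕ shift 1 (p ⊕ shift 1 p)
    ≈⟨ ⊕-cong (≋-refl {p}) (shift-⊕ 1 p (shift 1 p)) ⟩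
  p ⊕ (shift 1 p ⊕ shift 1 (shift 1 p))
    ≈⟨ ⊕-cong (≋-refl {p}) (⊕-cong (≋-refl {shift 1 p}) (shift-shift 1 1 p)) ⟩
  p ⊕ (shift 1 p ⊕ shift 2 p) ∎
  where
  open SetoidReasoning ≋-setoid
  q1⊗p : scale 1 p ⊕ shift 1 [] ≋ p
  q1⊗p = ≋-trans (⊕-cong (scale-1 p) (shift-[] 1)) (⊕-identityʳ p)

-- Generating functions of weighted lists

module _ {A : Set} where

  gf : (A → ℕ) → List A → Poly
  gf w = foldr (λ a p → monomial (w a) ⊕ p) []

  gf-++ : ∀ (w : A → ℕ) xs ys → gf w (xs ++ ys) ≋ gf w xs ⊕ gf w ys
  gf-++ w []       ys = ≋-refl
  gf-++ w (x ∷ xs) ys =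
    ≋-trans (⊕-cong ≋-refl (gf-++ w xs ys)) (≋-sym (⊕-assoc (monomial (w x)) _ _))

  gf-cong : ∀ {w w′ : A → ℕ} {xs} → All (λ x → w x ≡ w′ x) xs → gf w xs ≡ gf w′ xs
  gf-cong []       = ≡.refl
  gf-cong (e ∷ es) = cong₂ (λ a p → monomial a ⊕ p) e (gf-cong es)

  gf-shift : ∀ s (w w′ : A → ℕ) → (∀ x → w′ x ≡ s + w x) → ∀ xs → gf w′ xs ≋ shift s (gf w xs)
  gf-shift s w w′ e []       = ≋-sym (shift-[] s)
  gf-shift s w w′ e (x ∷ xs) rewrite e x = begin
    monomial (s + w x) ⊕ gf w′ xs                 ≈⟨ ⊕-cong (≋-sym (shift-monomial s (w x))) (gf-shift s w w′ e xs) ⟩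
    shift s (monomial (w x)) ⊕ shift s (gf w xs)  ≈⟨ shift-⊕ s _ _ ⟨
    shift s (monomial (w x) ⊕ gf w xs)            ∎
    where open SetoidReasoning ≋-setoid

  gf-↭ : ∀ (w : A → ℕ) {xs ys} → xs ↭ ys → gf w xs ≋ gf w ys
  gf-↭ w refl          = ≋-refl
  gf-↭ w (prep x p)    = ⊕-cong ≋-refl (gf-↭ w p)
  gf-↭ w (swap {xs} {ys} x y p) = begin
    monomial (w x) ⊕ (monomial (w y) ⊕ gf w xs) ≈⟨ ⊕-assoc (monomial (w x)) _ _ ⟨
    (monomial (w x) ⊕ monomial (w y)) ⊕ gf w xs ≈⟨ ⊕-cong (⊕-comm (monomial (w x)) _) (gf-↭ w p) ⟩
    (monomial (w y) ⊕ monomial (w x)) ⊕ gf w ys ≈⟨ ⊕-assoc (monomial (w y)) _ _ ⟩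
    monomial (w y) ⊕ (monomial (w x) ⊕ gf w ys) ∎
    where open SetoidReasoning ≋-setoid
  gf-↭ w (trans p p′) = ≋-trans (gf-↭ w p) (gf-↭ w p′)

gf-map : ∀ {A B : Set} (w : B → ℕ) (f : A → B) xs → gf w (map f xs) ≡ gf (w ∘ f) xs
gf-map w f []       = ≡.refl
gf-map w f (x ∷ xs) = cong (monomial (w (f x)) ⊕_) (gf-map w f xs)

gf-bijection : ∀ {A B : Set} (w : B → ℕ) (f : A → B) (g : B → A) {xs ys} →
               Unique xs → Unique ys →
               (∀ {x} → x ∈ xs → f x ∈ ys × g (f x) ≡ x) →
               (∀ {y} → y ∈ ys → ∃ λ x → x ∈ xs × f x ≡ y) →
               gf w ys ≋ gf (w ∘ f) xs
gf-bijection w f g {xs} {ys} xs! ys! into onto =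
  ≋-trans (gf-↭ w (↭-sym image↭ys)) (≡⇒≋ (gf-map w f xs))
  where
  image! : Unique (map f xs)
  image! = Unique.map⁻ {f = g} (subst Unique (≡.sym (≡.trans (≡.sym (map-∘ {g = g} {f = f} xs)) (map-id-local (tabulate (proj₂ ∘ into))))) xs!)
  image↭ys : map f xs ↭ ys
  image↭ys = ∼bag⇒↭ (unique∧set⇒bag image! ys! (mk⇔
    (λ y∈ → let x , x∈ , y≡fx = ∈-map⁻ f y∈ in subst (_∈ ys) (≡.sym y≡fx) (proj₁ (into x∈)))
    (λ y∈ → let x , x∈ , fx≡y = onto y∈ in subst (_∈ map f xs) fx≡y (∈-map⁺ f x∈))))

tagged-unique : ∀ {A : Set} (t : ℕ) {xs : List A} → Unique xs → Unique (map (t ,_) xs)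
tagged-unique t = Unique.map⁺ λ { ≡.refl → ≡.refl }

tagged-disjoint : ∀ {A : Set} {t} {xs : List A} {ys : List (ℕ × A)} →
                  All (λ y → t ≢ proj₁ y) ys → Disjoint (map (t ,_) xs) ys
tagged-disjoint other-tags (x∈ , y∈) with _ , _ , ≡.refl ← ∈-map⁻ _ x∈ = All.lookup other-tags y∈ ≡.refl

filterB≡filter : ∀ {A : Set} (p : A → Bool) xs → filterB p xs ≡ filter (T? ∘ p) xs
filterB≡filter p []       = ≡.refl
filterB≡filter p (x ∷ xs) with p x
... | true  = cong (x ∷_) (filterB≡filter p xs)
... | false = filterB≡filter p xs

T-allB : ∀ {A : Set} (p : A → Bool) xs → T (allB p xs) ⇔ All (T ∘ p) xs
T-allB p []       = mk⇔ (λ _ → []) (λ _ → _)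
T-allB p (x ∷ xs) = mk⇔
  (λ t → let px , pxs = Equivalence.to T-∧ t in px ∷ Equivalence.to (T-allB p xs) pxs)
  (λ { (px ∷ pxs) → Equivalence.from T-∧ (px , Equivalence.from (T-allB p xs) pxs) })

InRange : ℕ → ℕ → Set
InRange K x = 1 ≤ x × x ≤ K

∈-range⁻ : ∀ {K x} → x ∈ range K → InRange K x
∈-range⁻ x∈ with i , i∈ , ≡.refl ← ∈-map⁻ suc x∈ = s≤s z≤n , ∈-upTo⁻ i∈

∈-range⁺ : ∀ {K x} → InRange K x → x ∈ range K
∈-range⁺ {x = suc x} (_ , x≤K) = ∈-map⁺ suc (∈-upTo⁺ x≤K)

range-unique : ∀ K → Unique (range K)
range-unique K = Unique.map⁺ suc-injective (Unique.upTo⁺ K)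

words-suc : ∀ m (xs : List ℕ) → words (suc m) xs ≡ cartesianProductWith _∷_ xs (words m xs)
words-suc m xs = go xs
  where
  go : ∀ zs → concatMap (λ z → map (z ∷_) (words m xs)) zs ≡ cartesianProductWith _∷_ zs (words m xs)
  go []       = ≡.refl
  go (z ∷ zs) = cong (map (z ∷_) (words m xs) ++_) (go zs)

∈-words⁻ : ∀ m (xs : List ℕ) {w} → w ∈ words m xs → length w ≡ m × All (_∈ xs) w
∈-words⁻ zero    xs (here ≡.refl) = ≡.refl , []
∈-words⁻ (suc m) xs w∈
  with a , v , a∈ , v∈ , ≡.refl ← ∈-cartesianProductWith⁻ _∷_ xs (words m xs) (subst (_ ∈_) (words-suc m xs) w∈)
  = let len , all = ∈-words⁻ m xs v∈ in cong suc len , a∈ ∷ all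

∈-words⁺ : ∀ m (xs : List ℕ) {w} → length w ≡ m → All (_∈ xs) w → w ∈ words m xs
∈-words⁺ zero    xs {[]}    ≡.refl []         = here ≡.refl
∈-words⁺ (suc m) xs {a ∷ v} ≡.refl (a∈ ∷ all) =
  subst (_ ∈_) (≡.sym (words-suc m xs)) (∈-cartesianProductWith⁺ _∷_ a∈ (∈-words⁺ m xs ≡.refl all))

words-unique : ∀ m (xs : List ℕ) → Unique xs → Unique (words m xs)
words-unique zero    xs xs! = [] ∷ []
words-unique (suc m) xs xs! = subst Unique (≡.sym (words-suc m xs))
  (Unique.cartesianProductWith⁺ _∷_ ∷-injective xs! (words-unique m xs xs!))
  where
  ∷-injective : ∀ {a b : ℕ} {v u} → a ∷ v ≡ b ∷ u → a ≡ b × v ≡ u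
  ∷-injective ≡.refl = ≡.refl , ≡.refl

colCount-here : ∀ j w → colCount j (j ∷ w) ≡ suc (colCount j w)
colCount-here j w = cong length (filter-accept (j ≟_) ≡.refl)

colCount-there : ∀ {j c} w → j ≢ c → colCount j (c ∷ w) ≡ colCount j w
colCount-there w j≢c = cong length (filter-reject (_ ≟_) j≢c)

colCount-++ : ∀ j xs ys → colCount j (xs ++ ys) ≡ colCount j xs + colCount j ys
colCount-++ j xs ys = ≡.trans (cong length (filter-++ (j ≟_) xs ys)) (length-++ (filter (j ≟_) xs))

colCount-↭ : ∀ j {xs ys} → xs ↭ ys → colCount j xs ≡ colCount j ys
colCount-↭ j p = ↭-length (filter-↭ (j ≟_) p)

colCount-absent : ∀ {j} w → All (j ≢_) w → colCount j w ≡ 0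
colCount-absent w j∉w = cong length (filter-none (_ ≟_) j∉w)

colCount≡0⇒absent : ∀ {j} w → colCount j w ≡ 0 → All (j ≢_) w
colCount≡0⇒absent []      _ = []
colCount≡0⇒absent {j} (c ∷ w) e with j ≟ c
... | yes ≡.refl = contradiction (≡.trans (≡.sym (colCount-here j w)) e) λ ()
... | no j≢c     = j≢c ∷ colCount≡0⇒absent w (≡.trans (≡.sym (colCount-there w j≢c)) e)

colCount≡suc⇒split : ∀ {c n} w → colCount c w ≡ suc n →
  ∃ λ P → ∃ λ r → w ≡ P ++ c ∷ r × All (c ≢_) P × colCount c r ≡ n
colCount≡suc⇒split {c} (x ∷ w) e with c ≟ x
... | yes ≡.refl = [] , w , ≡.refl , [] , suc-injective (≡.trans (≡.sym (colCount-here c w)) e)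
... | no c≢x with P , r , ≡.refl , c∉P , e′ ← colCount≡suc⇒split w (≡.trans (≡.sym (colCount-there w c≢x)) e)
  = x ∷ P , r , ≡.refl , c≢x ∷ c∉P , e′

colCount-single : ∀ {c} xs ys → All (c ≢_) xs → All (c ≢_) ys → colCount c (xs ++ c ∷ ys) ≡ 1
colCount-single {c} xs ys c∉xs c∉ys = ≡.trans (colCount-++ c xs (c ∷ ys))
  (cong₂ _+_ (colCount-absent xs c∉xs) (≡.trans (colCount-here c ys) (cong suc (colCount-absent ys c∉ys))))

T-not-<ᵇ : ∀ m n → T (not (m <ᵇ n)) ⇔ n ≤ m
T-not-<ᵇ m n with m <ᵇ n in eq
... | true  = mk⇔ (λ ()) (λ n≤m → ≤⇒≯ n≤m (<ᵇ⇒< m n (subst T (≡.sym eq) tt)))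
... | false = mk⇔ (λ _ → ≮⇒≥ (λ m<n → subst T eq (<⇒<ᵇ m<n))) (λ _ → tt)

Stair : ℕ → ℕ → ℕ → Set
Stair K i c = i ≤ suc K ⊎ c + i < 2 * K + 2

RowOK : ℕ → List ℕ → ℕ → ℕ → Set
RowOK K Λ i c = part Λ i < c × Stair K i c

data Rows (K : ℕ) (Λ : List ℕ) : ℕ → List ℕ → Set where
  []  : ∀ {i} → Rows K Λ i []
  _∷_ : ∀ {i c w} → RowOK K Λ i c → Rows K Λ (suc i) w → Rows K Λ i (c ∷ w)

T-rowsOK : ∀ K Λ i w → T (rowsOK K Λ i w) ⇔ Rows K Λ i w
T-rowsOK K Λ i []      = mk⇔ (λ _ → []) (λ _ → tt)
T-rowsOK K Λ i (c ∷ w) = mk⇔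
  (λ t → let below , rest = Equivalence.to T-∧ t
             stair , rows = Equivalence.to T-∧ rest
         in (<ᵇ⇒< _ _ below , Sum.map (Equivalence.to (T-not-<ᵇ (suc K) i)) (<ᵇ⇒< _ _) (Equivalence.to T-∨ stair))
            ∷ Equivalence.to (T-rowsOK K Λ (suc i) w) rows)
  (λ { ((below , stair) ∷ rows) → Equivalence.from T-∧ (<⇒<ᵇ below , Equivalence.from T-∧
         (Equivalence.from T-∨ (Sum.map (Equivalence.from (T-not-<ᵇ (suc K) i)) <⇒<ᵇ stair) ,
          Equivalence.from (T-rowsOK K Λ (suc i) w) rows)) })

module _ {K : ℕ} {Λ : List ℕ} where

  Rows-++⁻ : ∀ {i} xs {ys} → Rows K Λ i (xs ++ ys) → Rows K Λ i xs × Rows K Λ (i + length xs) ys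
  Rows-++⁻     []       {ys} rows          = [] , subst (λ t → Rows K Λ t ys) (≡.sym (+-identityʳ _)) rows
  Rows-++⁻ {i} (x ∷ xs) {ys} (x-ok ∷ rows) =
    let xs-ok , ys-ok = Rows-++⁻ xs rows
    in x-ok ∷ xs-ok , subst (λ t → Rows K Λ t ys) (≡.sym (+-suc i (length xs))) ys-ok

  Rows-++⁺ : ∀ {i} xs {ys} → Rows K Λ i xs → Rows K Λ (i + length xs) ys → Rows K Λ i (xs ++ ys)
  Rows-++⁺     []       {ys} []             ys-ok = subst (λ t → Rows K Λ t ys) (+-identityʳ _) ys-ok
  Rows-++⁺ {i} (x ∷ xs) {ys} (x-ok ∷ xs-ok) ys-ok =
    x-ok ∷ Rows-++⁺ xs xs-ok (subst (λ t → Rows K Λ t ys) (+-suc i (length xs)) ys-ok)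

  Rows-transfer : ∀ {K′ Λ′ i i′ w} {Q : ℕ → Set} → All Q w →
    (∀ s {c} → s < length w → Q c → RowOK K Λ (i + s) c → RowOK K′ Λ′ (i′ + s) c) →
    Rows K Λ i w → Rows K′ Λ′ i′ w
  Rows-transfer []         transfer []             = []
  Rows-transfer {K′} {Λ′} {i} {i′} {c ∷ w} {Q} (q ∷ qs) transfer (c-ok ∷ rows) =
    at-head ∷ Rows-transfer qs transfer′ rows
    where
    at-head : RowOK K′ Λ′ i′ c
    at-head = subst (λ t → RowOK K′ Λ′ t c) (+-identityʳ i′)
      (transfer 0 (s≤s z≤n) q (subst (λ t → RowOK K Λ t c) (≡.sym (+-identityʳ i)) c-ok))
    transfer′ : ∀ s {c} → s < length w → Q c → RowOK K Λ (suc i + s) c → RowOK K′ Λ′ (suc i′ + s) c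
    transfer′ s {c} s< qc ok = subst (λ t → RowOK K′ Λ′ t c) (+-suc i′ s)
      (transfer (suc s) (s≤s s<) qc (subst (λ t → RowOK K Λ t c) (≡.sym (+-suc i s)) ok))

private
  twice-suc : ∀ K → 2 * suc K ≡ suc (suc (2 * K))
  twice-suc = +-*-Solver.solve 1 (λ K → con 2 :* (con 1 :+ K) := con 2 :+ con 2 :* K) ≡.refl
    where open +-*-Solver

  suc-K+suc-K : ∀ K → suc (K + suc K) ≡ 2 * K + 2
  suc-K+suc-K = +-*-Solver.solve 1 (λ K → con 1 :+ (K :+ (con 1 :+ K)) := con 2 :* K :+ con 2) ≡.refl
    where open +-*-Solver

  plus-three : ∀ c t → c + suc (suc (suc t)) ≡ suc (suc (c + suc t))
  plus-three c t = ≡.trans (+-suc c (suc (suc t))) (cong suc (+-suc c (suc t)))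

  half≤ : ∀ L m → suc L ≡ 2 * suc m → suc m ≤ L
  half≤ L m e = subst (suc m ≤_) (suc-injective (≡.sym e))
    (≤-trans (m≤n+m (suc m) m) (≤-reflexive (cong (m +_) (≡.sym (+-identityʳ (suc m))))))

stair⇒sum : ∀ {K i c} → c ≤ K → Stair K i c → c + i < 2 * K + 2
stair⇒sum {K} {i} {c} c≤K (inj₁ i≤) = subst (suc (c + i) ≤_) (suc-K+suc-K K) (s≤s (+-mono-≤ c≤K i≤))
stair⇒sum     _   (inj₂ lt) = lt

Stair-shift₂⁺ : ∀ {K t c} → c ≤ K → Stair K (suc t) c → Stair (suc K) (3 + t) c
Stair-shift₂⁺ {K} {t} {c} c≤K stair =
  inj₂ (subst₂ _<_ (≡.sym (plus-three c t)) (≡.sym (cong (_+ 2) (twice-suc K))) (s≤s (s≤s (stair⇒sum c≤K stair))))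

Stair-shift₂⁻ : ∀ {K t c} → Stair (suc K) (3 + t) c → Stair K (suc t) c
Stair-shift₂⁻ (inj₁ (s≤s (s≤s le))) = inj₁ (m≤n⇒m≤1+n le)
Stair-shift₂⁻ {K} {t} {c} (inj₂ lt) with subst₂ _<_ (plus-three c t) (cong (_+ 2) (twice-suc K)) lt
... | s≤s (s≤s lt′) = inj₂ lt′

module _ {K : ℕ} {Λ : List ℕ} {t c : ℕ} where

  RowOK-shift₂⁺ : ∀ {a b} → c ≤ K → RowOK K Λ (suc t) c → RowOK (suc K) (a ∷ b ∷ Λ) (3 + t) c
  RowOK-shift₂⁺ c≤K (below , stair) = below , Stair-shift₂⁺ c≤K stair

  RowOK-shift₂⁻ : ∀ {a b} → RowOK (suc K) (a ∷ b ∷ Λ) (3 + t) c → RowOK K Λ (suc t) c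
  RowOK-shift₂⁻ (below , stair) = below , Stair-shift₂⁻ stair

  RowOK-shift₁⁺ : ∀ {a} → suc t ≤ K → RowOK K Λ (suc t) c → RowOK K (a ∷ Λ) (2 + t) c
  RowOK-shift₁⁺ t<K (below , _) = below , inj₁ (s≤s t<K)

  RowOK-shift₁⁻ : ∀ {a} → suc t ≤ K → RowOK K (a ∷ Λ) (2 + t) c → RowOK K Λ (suc t) c
  RowOK-shift₁⁻ t<K (below , _) = below , inj₁ (m≤n⇒m≤1+n t<K)

RowOK-part : ∀ {K Λ Λ′ i c} → part Λ i ≡ part Λ′ i → RowOK K Λ i c → RowOK K Λ′ i c
RowOK-part e (below , stair) = subst (_< _) e below , stair

RowOK-last : ∀ {K Λ i} → RowOK K Λ i K → i ≤ suc K
RowOK-last (_ , inj₁ i≤) = i≤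
RowOK-last {K} {i = i} (_ , inj₂ lt) =
  ≤-pred (+-cancelˡ-< K i (suc (suc K)) (subst (K + i <_) (≡.trans (≡.sym (suc-K+suc-K K)) (≡.sym (+-suc K (suc K)))) lt))

Rows-shift₂⁺ : ∀ {K Λ a b i w} → All (InRange K) w → Rows K Λ (suc i) w → Rows (suc K) (a ∷ b ∷ Λ) (3 + i) w
Rows-shift₂⁺ {K} {Λ} {a} {b} inRange =
  Rows-transfer inRange λ _ _ (_ , c≤K) → RowOK-shift₂⁺ {K} {Λ} {a = a} {b} c≤K

Rows-shift₂⁻ : ∀ {K Λ a b i w} → All (InRange K) w → Rows (suc K) (a ∷ b ∷ Λ) (3 + i) w → Rows K Λ (suc i) w
Rows-shift₂⁻ {K} {Λ} {a} {b} inRange =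
  Rows-transfer inRange λ _ _ _ → RowOK-shift₂⁻ {K} {Λ} {a = a} {b}

part≤head : ∀ xs → Linked _≥_ xs → ∀ t → part xs t ≤ part xs 1
part≤head []           _          t             = z≤n
part≤head (x ∷ xs)     _          zero          = z≤n
part≤head (x ∷ xs)     _          (suc zero)    = ≤-refl
part≤head (x ∷ [])     _          (suc (suc t)) = z≤n
part≤head (x ∷ y ∷ xs) (x≥y ∷ ys) (suc (suc t)) = ≤-trans (part≤head (y ∷ xs) ys (suc t)) x≥y

part-beyond : ∀ xs t → length xs < t → part xs t ≡ 0
part-beyond []       t             _              = ≡.refl
part-beyond (x ∷ xs) (suc (suc t)) (s≤s (s≤s l)) = part-beyond xs (suc t) (s≤s l)

-- Dellac configurations

ColumnsFull : ℕ → List ℕ → Set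
ColumnsFull K w = ∀ c → InRange K c → colCount c w ≡ 2

-- The part of isDellac that does not depend on the order of the dots: w is a word of length 2K
-- using each of the letters 1…K exactly twice.
record Balanced (K : ℕ) (w : List ℕ) : Set where
  constructor balanced
  field
    length≡ : length w ≡ 2 * K
    inRange : All (InRange K) w
    columns : ColumnsFull K w

record Dellac (K : ℕ) (Λ : List ℕ) (w : List ℕ) : Set where
  constructor dellac
  field
    isBalanced : Balanced K w
    rows       : Rows K Λ 1 w

dellacs : ℕ → List ℕ → List (List ℕ)
dellacs K Λ = filterB (isDellac K Λ) (words (2 * K) (range K))

T-columnsOK : ∀ K w → T (columnsOK K w) ⇔ ColumnsFull K w
T-columnsOK K w = mk⇔
  (λ t c c∈ → ≡ᵇ⇒≡ _ _ (All.lookup (Equivalence.to (T-allB _ (range K)) t) (∈-range⁺ c∈)))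
  (λ full → Equivalence.from (T-allB _ (range K)) (All.tabulate λ c∈ → ≡⇒≡ᵇ _ _ (full _ (∈-range⁻ c∈))))

∈-dellacs⁻ : ∀ {K Λ w} → w ∈ dellacs K Λ → Dellac K Λ w
∈-dellacs⁻ {K} {Λ} {w} w∈
  with w∈words , t ← ∈-filter⁻ (T? ∘ isDellac K Λ)
                       (subst (w ∈_) (filterB≡filter (isDellac K Λ) (words (2 * K) (range K))) w∈)
  with len , alphabet ← ∈-words⁻ (2 * K) (range K) w∈words
  with cols , rows ← Equivalence.to T-∧ t
  = dellac (balanced len (All.map ∈-range⁻ alphabet) (Equivalence.to (T-columnsOK K w) cols))
           (Equivalence.to (T-rowsOK K Λ 1 w) rows)

∈-dellacs⁺ : ∀ {K Λ w} → Dellac K Λ w → w ∈ dellacs K Λ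
∈-dellacs⁺ {K} {Λ} {w} (dellac (balanced len inRange cols) rows) =
  subst (w ∈_) (≡.sym (filterB≡filter (isDellac K Λ) (words (2 * K) (range K))))
    (∈-filter⁺ (T? ∘ isDellac K Λ) (∈-words⁺ (2 * K) (range K) len (All.map ∈-range⁺ inRange))
      (Equivalence.from T-∧ (Equivalence.from (T-columnsOK K w) cols , Equivalence.from (T-rowsOK K Λ 1 w) rows)))

dellacs-unique : ∀ K Λ → Unique (dellacs K Λ)
dellacs-unique K Λ = subst Unique (≡.sym (filterB≡filter (isDellac K Λ) (words (2 * K) (range K))))
  (Unique.filter⁺ (T? ∘ isDellac K Λ) (words-unique (2 * K) (range K) (range-unique K)))

Balanced-↭ : ∀ {K xs ys} → xs ↭ ys → Balanced K xs → Balanced K ys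
Balanced-↭ xs↭ys (balanced len inRange cols) =
  balanced (≡.trans (≡.sym (↭-length xs↭ys)) len) (All-resp-↭ xs↭ys inRange)
           (λ c c∈ → ≡.trans (≡.sym (colCount-↭ c xs↭ys)) (cols c c∈))

Balanced-prepend² : ∀ {K v} → Balanced K v → Balanced (suc K) (suc K ∷ suc K ∷ v)
Balanced-prepend² {K} {v} (balanced len inRange cols) =
  balanced (≡.trans (cong (suc ∘ suc) len) (≡.sym (twice-suc K)))
           (new ∷ new ∷ All.map (λ (1≤c , c≤K) → 1≤c , m≤n⇒m≤1+n c≤K) inRange)
           columns
  where
  new : InRange (suc K) (suc K)
  new = s≤s z≤n , ≤-refl
  columns : ColumnsFull (suc K) (suc K ∷ suc K ∷ v)
  columns c (1≤c , c≤1+K) with m≤n⇒m<n∨m≡n c≤1+K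
  ... | inj₂ ≡.refl = begin
    colCount (suc K) (suc K ∷ suc K ∷ v)  ≡⟨ colCount-here (suc K) (suc K ∷ v) ⟩
    suc (colCount (suc K) (suc K ∷ v))    ≡⟨ cong suc (colCount-here (suc K) v) ⟩
    suc (suc (colCount (suc K) v))        ≡⟨ cong (suc ∘ suc) (colCount-absent v
                                               (All.map (λ (_ , c≤K) → <⇒≢ (s≤s c≤K) ∘ ≡.sym) inRange)) ⟩
    2                                     ∎
    where open ≡.≡-Reasoning
  ... | inj₁ (s≤s c≤K) = ≡.trans (colCount-there (suc K ∷ v) (<⇒≢ (s≤s c≤K)))
                           (≡.trans (colCount-there v (<⇒≢ (s≤s c≤K))) (cols c (1≤c , c≤K)))

Balanced-drop² : ∀ {K v} → Balanced (suc K) (suc K ∷ suc K ∷ v) → Balanced K v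
Balanced-drop² {K} {v} (balanced len (_ ∷ _ ∷ inRange) cols) =
  balanced (suc-injective (suc-injective (≡.trans len (twice-suc K))))
           (All.zipWith (λ ((1≤c , c≤1+K) , 1+K≢c) → 1≤c , ≤-pred (≤∧≢⇒< c≤1+K (1+K≢c ∘ ≡.sym))) (inRange , no-last))
           (λ c (1≤c , c≤K) → ≡.trans (≡.sym (colCount-there v (<⇒≢ (s≤s c≤K))))
             (≡.trans (≡.sym (colCount-there (suc K ∷ v) (<⇒≢ (s≤s c≤K)))) (cols c (1≤c , m≤n⇒m≤1+n c≤K))))
  where
  no-last : All (suc K ≢_) v
  no-last = colCount≡0⇒absent v (suc-injective (suc-injective (≡.trans
    (≡.sym (≡.trans (colCount-here (suc K) (suc K ∷ v)) (cong suc (colCount-here (suc K) v))))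
    (cols (suc K) (s≤s z≤n , ≤-refl)))))

-- Inversions

countB : (ℕ → Bool) → List ℕ → ℕ
countB p xs = length (filterB p xs)

module _ (p : ℕ → Bool) where

  private
    countB≡ : ∀ xs → countB p xs ≡ length (filter (T? ∘ p) xs)
    countB≡ xs = cong length (filterB≡filter p xs)

  countB-++ : ∀ xs ys → countB p (xs ++ ys) ≡ countB p xs + countB p ys
  countB-++ xs ys = begin
    countB p (xs ++ ys)                                          ≡⟨ countB≡ (xs ++ ys) ⟩
    length (filter (T? ∘ p) (xs ++ ys))                           ≡⟨ cong length (filter-++ (T? ∘ p) xs ys) ⟩
    length (filter (T? ∘ p) xs ++ filter (T? ∘ p) ys)             ≡⟨ length-++ (filter (T? ∘ p) xs) ⟩
    length (filter (T? ∘ p) xs) + length (filter (T? ∘ p) ys)     ≡⟨ cong₂ _+_ (countB≡ xs) (countB≡ ys) ⟨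
    countB p xs + countB p ys                                    ∎
    where open ≡.≡-Reasoning

  countB-↭ : ∀ {xs ys} → xs ↭ ys → countB p xs ≡ countB p ys
  countB-↭ {xs} {ys} xs↭ys =
    ≡.trans (countB≡ xs) (≡.trans (↭-length (filter-↭ (T? ∘ p) xs↭ys)) (≡.sym (countB≡ ys)))

  countB-none : ∀ {xs} → All (λ x → ¬ T (p x)) xs → countB p xs ≡ 0
  countB-none {xs} none = ≡.trans (countB≡ xs) (cong length (filter-none (T? ∘ p) none))

  countB-all : ∀ {xs} → All (T ∘ p) xs → countB p xs ≡ length xs
  countB-all {xs} all = ≡.trans (countB≡ xs) (cong length (filter-all (T? ∘ p) all))

countAbove countBelow : ℕ → List ℕ → ℕ
countAbove c = countB (c <ᵇ_)

countBelow c = countB (_<ᵇ c)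

inv-extract : ∀ P c r → inv (P ++ c ∷ r) ≡ countBelow c P + countAbove c r + inv (P ++ r)
inv-extract []      c r = ≡.refl
inv-extract (x ∷ P) c r = begin
  countAbove x (P ++ c ∷ r) + inv (P ++ c ∷ r)
    ≡⟨ cong₂ _+_ above-split (inv-extract P c r) ⟩
  (countAbove x (c ∷ []) + countAbove x (P ++ r)) + (countBelow c P + countAbove c r + inv (P ++ r))
    ≡⟨ cong (λ a → (a + _) + _) (pair x c) ⟩
  (countBelow c (x ∷ []) + countAbove x (P ++ r)) + (countBelow c P + countAbove c r + inv (P ++ r))
    ≡⟨ rearrange (countBelow c (x ∷ [])) _ _ _ _ ⟩
  (countBelow c (x ∷ []) + countBelow c P) + countAbove c r + (countAbove x (P ++ r) + inv (P ++ r))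
    ≡⟨ cong (λ b → b + countAbove c r + _) (countB-++ (_<ᵇ c) (x ∷ []) P) ⟨
  countBelow c (x ∷ P) + countAbove c r + inv (x ∷ P ++ r) ∎
  where
  open ≡.≡-Reasoning
  above-split : countAbove x (P ++ c ∷ r) ≡ countAbove x (c ∷ []) + countAbove x (P ++ r)
  above-split = ≡.trans (countB-↭ (x <ᵇ_) (↭-shift c P r)) (countB-++ (x <ᵇ_) (c ∷ []) (P ++ r))
  pair : ∀ x c → countAbove x (c ∷ []) ≡ countBelow c (x ∷ [])
  pair x c with x <ᵇ c
  ... | true  = ≡.refl
  ... | false = ≡.refl
  rearrange : ∀ a b d e f → (a + b) + (d + e + f) ≡ (a + d) + e + (b + f)
  rearrange = +-*-Solver.solve 5 (λ a b d e f → (a :+ b) :+ (d :+ e :+ f) := (a :+ d) :+ e :+ (b :+ f)) ≡.refl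
    where open +-*-Solver

countAbove-none : ∀ {c w} → All (_≤ c) w → countAbove c w ≡ 0
countAbove-none = countB-none _ ∘ All.map (λ x≤c t → ≤⇒≯ x≤c (<ᵇ⇒< _ _ t))

countBelow-all : ∀ {c w} → All (_< c) w → countBelow c w ≡ length w
countBelow-all = countB-all _ ∘ All.map <⇒<ᵇ

countBelow+colCount : ∀ {c} w → All (_≤ c) w → countBelow c w + colCount c w ≡ length w
countBelow+colCount []      []           = ≡.refl
countBelow+colCount {c} (x ∷ w) (x≤c ∷ w≤c) with m≤n⇒m<n∨m≡n x≤c
... | inj₁ x<c = begin
  countBelow c (x ∷ w) + colCount c (x ∷ w)  ≡⟨ cong₂ _+_ (countB-++ (_<ᵇ c) (x ∷ []) w) (colCount-there w (<⇒≢ x<c ∘ ≡.sym)) ⟩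
  countBelow c (x ∷ []) + countBelow c w + colCount c w  ≡⟨ cong (λ b → b + countBelow c w + colCount c w) (countBelow-all (x<c ∷ [])) ⟩
  suc (countBelow c w + colCount c w)        ≡⟨ cong suc (countBelow+colCount w w≤c) ⟩
  suc (length w)                             ∎
  where open ≡.≡-Reasoning
... | inj₂ ≡.refl = begin
  countBelow c (c ∷ w) + colCount c (c ∷ w)  ≡⟨ cong₂ _+_ (countB-++ (_<ᵇ c) (c ∷ []) w) (colCount-here c w) ⟩
  countBelow c (c ∷ []) + countBelow c w + suc (colCount c w)  ≡⟨ cong (λ b → b + countBelow c w + suc (colCount c w)) (countAbove-none {c} (≤-refl ∷ [])) ⟩
  countBelow c w + suc (colCount c w)        ≡⟨ +-suc (countBelow c w) _ ⟩
  suc (countBelow c w + colCount c w)        ≡⟨ cong suc (countBelow+colCount w w≤c) ⟩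
  suc (length w)                             ∎
  where open ≡.≡-Reasoning

inv-extract-max : ∀ P {c} r → All (_≤ c) r → inv (P ++ c ∷ r) ≡ countBelow c P + inv (P ++ r)
inv-extract-max P {c} r r≤c = begin
  inv (P ++ c ∷ r)                                   ≡⟨ inv-extract P c r ⟩
  countBelow c P + countAbove c r + inv (P ++ r)     ≡⟨ cong (λ a → countBelow c P + a + inv (P ++ r)) (countAbove-none r≤c) ⟩
  countBelow c P + 0 + inv (P ++ r)                  ≡⟨ cong (_+ inv (P ++ r)) (+-identityʳ (countBelow c P)) ⟩
  countBelow c P + inv (P ++ r)                      ∎
  where open ≡.≡-Reasoning

≡ᵇ-refl : ∀ n → (n ≡ᵇ n) ≡ true
≡ᵇ-refl zero    = ≡.refl
≡ᵇ-refl (suc n) = ≡ᵇ-refl n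

≡ᵇ-≢ : ∀ {m n} → m ≢ n → (m ≡ᵇ n) ≡ false
≡ᵇ-≢ {m} {n} m≢n with m ≡ᵇ n in eq
... | true  = contradiction (≡ᵇ⇒≡ m n (subst T (≡.sym eq) tt)) m≢n
... | false = ≡.refl

-- Indices count from 0, and nth returns 0 past the end of the word.
nth : List ℕ → ℕ → ℕ
nth []       _       = 0
nth (x ∷ xs) zero    = x
nth (x ∷ xs) (suc i) = nth xs i

deleteAt : ℕ → List ℕ → List ℕ
deleteAt _       []       = []
deleteAt zero    (x ∷ xs) = xs
deleteAt (suc i) (x ∷ xs) = x ∷ deleteAt i xs

insertAt : ℕ → ℕ → List ℕ → List ℕ
insertAt zero    c xs       = c ∷ xs
insertAt (suc i) c []       = c ∷ []
insertAt (suc i) c (x ∷ xs) = x ∷ insertAt i c xs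

replaceFirst : ℕ → ℕ → List ℕ → List ℕ
replaceFirst a b []       = []
replaceFirst a b (x ∷ xs) = if a ≡ᵇ x then b ∷ xs else x ∷ replaceFirst a b xs

replaceSecond : ℕ → ℕ → List ℕ → List ℕ
replaceSecond a b []       = []
replaceSecond a b (x ∷ xs) = x ∷ (if a ≡ᵇ x then replaceFirst a b xs else replaceSecond a b xs)

replaceAll : ℕ → ℕ → List ℕ → List ℕ
replaceAll a b = map λ x → if a ≡ᵇ x then b else x

occursBefore : ℕ → ℕ → List ℕ → Bool
occursBefore a b []       = false
occursBefore a b (x ∷ xs) = if a ≡ᵇ x then true else if b ≡ᵇ x then false else occursBefore a b xs

nth-length-++ : ∀ P c r {i} → length P ≡ i → nth (P ++ c ∷ r) i ≡ c
nth-length-++ []      c r ≡.refl = ≡.refl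
nth-length-++ (x ∷ P) c r ≡.refl = nth-length-++ P c r ≡.refl

nth-++ : ∀ P r i → nth (P ++ r) (length P + i) ≡ nth r i
nth-++ []      r i = ≡.refl
nth-++ (x ∷ P) r i = nth-++ P r i

nth-absent : ∀ {c} r i → All (c ≢_) r → c ≢ 0 → nth r i ≢ c
nth-absent []      i       _            c≢0 e = c≢0 (≡.sym e)
nth-absent (x ∷ r) zero    (c≢x ∷ _)    _   e = c≢x (≡.sym e)
nth-absent (x ∷ r) (suc i) (_ ∷ c∉r)    c≢0 e = nth-absent r i c∉r c≢0 e

deleteAt-length-++ : ∀ P c r {i} → length P ≡ i → deleteAt i (P ++ c ∷ r) ≡ P ++ r
deleteAt-length-++ []      c r ≡.refl = ≡.refl
deleteAt-length-++ (x ∷ P) c r ≡.refl = cong (x ∷_) (deleteAt-length-++ P c r ≡.refl)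

insertAt-length-++ : ∀ P c r {i} → length P ≡ i → insertAt i c (P ++ r) ≡ P ++ c ∷ r
insertAt-length-++ []      c r ≡.refl = ≡.refl
insertAt-length-++ (x ∷ P) c r ≡.refl = cong (x ∷_) (insertAt-length-++ P c r ≡.refl)

module _ {a b : ℕ} where

  replaceFirst-++ : ∀ P r → All (a ≢_) P → replaceFirst a b (P ++ a ∷ r) ≡ P ++ b ∷ r
  replaceFirst-++ []      r []          rewrite ≡ᵇ-refl a = ≡.refl
  replaceFirst-++ (x ∷ P) r (a≢x ∷ a∉P) rewrite ≡ᵇ-≢ a≢x = cong (x ∷_) (replaceFirst-++ P r a∉P)

  replaceSecond-++ : ∀ P Q r → All (a ≢_) P → All (a ≢_) Q →
                     replaceSecond a b (P ++ a ∷ Q ++ a ∷ r) ≡ P ++ a ∷ Q ++ b ∷ r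
  replaceSecond-++ []      Q r []          a∉Q rewrite ≡ᵇ-refl a = cong (a ∷_) (replaceFirst-++ Q r a∉Q)
  replaceSecond-++ (x ∷ P) Q r (a≢x ∷ a∉P) a∉Q rewrite ≡ᵇ-≢ a≢x = cong (x ∷_) (replaceSecond-++ P Q r a∉P a∉Q)

  replaceAll-absent : ∀ P → All (a ≢_) P → replaceAll a b P ≡ P
  replaceAll-absent []      []          = ≡.refl
  replaceAll-absent (x ∷ P) (a≢x ∷ a∉P) rewrite ≡ᵇ-≢ a≢x = cong (x ∷_) (replaceAll-absent P a∉P)

  replaceAll-++ : ∀ P r → All (a ≢_) P → All (a ≢_) r → replaceAll a b (P ++ a ∷ r) ≡ P ++ b ∷ r
  replaceAll-++ []      r []          a∉r rewrite ≡ᵇ-refl a = cong (b ∷_) (replaceAll-absent r a∉r)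
  replaceAll-++ (x ∷ P) r (a≢x ∷ a∉P) a∉r rewrite ≡ᵇ-≢ a≢x = cong (x ∷_) (replaceAll-++ P r a∉P a∉r)

  occursBefore-first : ∀ P r → All (λ x → a ≢ x × b ≢ x) P → occursBefore a b (P ++ a ∷ r) ≡ true
  occursBefore-first []      r []                  rewrite ≡ᵇ-refl a = ≡.refl
  occursBefore-first (x ∷ P) r ((a≢x , b≢x) ∷ P′) rewrite ≡ᵇ-≢ a≢x | ≡ᵇ-≢ b≢x = occursBefore-first P r P′

  occursBefore-second : ∀ P r → a ≢ b → All (λ x → a ≢ x × b ≢ x) P → occursBefore a b (P ++ b ∷ r) ≡ false
  occursBefore-second []      r a≢b []                  rewrite ≡ᵇ-≢ a≢b | ≡ᵇ-refl b = ≡.refl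
  occursBefore-second (x ∷ P) r a≢b ((a≢x , b≢x) ∷ P′) rewrite ≡ᵇ-≢ a≢x | ≡ᵇ-≢ b≢x = occursBefore-second P r a≢b P′

length-< : ∀ {A : Set} (xs : List A) {y} ys → length xs < length (xs ++ y ∷ ys)
length-< []       ys = s≤s z≤n
length-< (x ∷ xs) ys = s≤s (length-< xs ys)

-- In the notation of the theorem, N = n, k = n - 1 and j = n - 3.
module Decomposition (j : ℕ) (λs : List ℕ) (part≤j : ∀ t → part λs t ≤ j) (length≤k : length λs ≤ suc (suc j)) where

  k N : ℕ
  k = suc (suc j)
  N = suc k

  ΛW ΛU : List ℕ
  ΛW = k ∷ suc j ∷ λs
  ΛU = suc j ∷ λs

  part<k : ∀ t → part λs t < k
  part<k t = s≤s (m≤n⇒m≤1+n (part≤j t))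

  k∈ : InRange k k
  k∈ = s≤s z≤n , ≤-refl

  N∉ : ∀ {w} → All (InRange k) w → All (N ≢_) w
  N∉ = All.map λ (_ , c≤k) → <⇒≢ (s≤s c≤k) ∘ ≡.sym

  Nk↭NN : ∀ P r → N ∷ k ∷ P ++ N ∷ r ↭ N ∷ N ∷ P ++ k ∷ r
  Nk↭NN P r = prep N (trans (prep k (↭-shift N P r)) (trans (swap k N refl) (prep N (↭-sym (↭-shift k P r)))))

  front↭ : ∀ P r → k ∷ P ++ r ↭ P ++ k ∷ r
  front↭ P r = ↭-sym (↭-shift k P r)

  dellac-NN⁺ : ∀ {v} → Dellac k λs v → Dellac N ΛW (N ∷ N ∷ v)
  dellac-NN⁺ (dellac b rows) = dellac (Balanced-prepend² b)
    ((≤-refl , inj₁ (s≤s z≤n)) ∷ (m≤n⇒m≤1+n ≤-refl , inj₁ (s≤s (s≤s z≤n))) ∷ Rows-shift₂⁺ (Balanced.inRange b) rows)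

  dellac-NN⁻ : ∀ {v} → Dellac N ΛW (N ∷ N ∷ v) → Dellac k λs v
  dellac-NN⁻ (dellac b (_ ∷ _ ∷ rows)) = dellac b′ (Rows-shift₂⁻ (Balanced.inRange b′) rows)
    where b′ = Balanced-drop² b

  dellac-Nk⁺ : ∀ P {r} → length P < k → Dellac k λs (P ++ k ∷ r) → Dellac N ΛW (N ∷ k ∷ P ++ N ∷ r)
  dellac-Nk⁺ P {r} P<k (dellac b rows)
    with P-in , _ ∷ r-in ← All.++⁻ P (Balanced.inRange b)
    with P-rows , _ ∷ r-rows ← Rows-++⁻ P rows
    = dellac (Balanced-↭ (↭-sym (Nk↭NN P r)) (Balanced-prepend² b))
        ((≤-refl , inj₁ (s≤s z≤n)) ∷ (≤-refl , inj₁ (s≤s (s≤s z≤n))) ∷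
         Rows-++⁺ P (Rows-shift₂⁺ P-in P-rows)
           ((m≤n⇒m≤1+n (part<k (suc (length P))) , inj₁ (s≤s (s≤s P<k))) ∷ Rows-shift₂⁺ r-in r-rows))

  dellac-Nk⁻ : ∀ P {r} → length P < k → Dellac N ΛW (N ∷ k ∷ P ++ N ∷ r) → Dellac k λs (P ++ k ∷ r)
  dellac-Nk⁻ P {r} P<k (dellac b (_ ∷ _ ∷ rows))
    with b′ ← Balanced-drop² (Balanced-↭ (Nk↭NN P r) b)
    with P-in , _ ∷ r-in ← All.++⁻ P (Balanced.inRange b′)
    with P-rows , _ ∷ r-rows ← Rows-++⁻ P rows
    = dellac b′ (Rows-++⁺ P (Rows-shift₂⁻ P-in P-rows)
                  ((part<k (suc (length P)) , inj₁ (s≤s (<⇒≤ P<k))) ∷ Rows-shift₂⁻ r-in r-rows))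

  private
    parts-beyond : ∀ (P : List ℕ) s → length P ≡ k → part λs (2 + length P + s) ≡ part ΛU (2 + length P + s)
    parts-beyond P s P≡k =
      ≡.trans (part-beyond λs _ (s≤s (m≤n⇒m≤1+n λs≤))) (≡.sym (part-beyond λs _ (s≤s λs≤)))
      where
      λs≤ : length λs ≤ length P + s
      λs≤ = ≤-trans length≤k (subst (_≤ length P + s) P≡k (m≤m+n (length P) s))

  dellac-front⁺ : ∀ P {r} → length P ≡ k → Dellac k λs (P ++ k ∷ r) → Dellac k ΛU (k ∷ P ++ r)
  dellac-front⁺ P {r} P≡k (dellac b rows)
    with P-in , _ ∷ r-in ← All.++⁻ P (Balanced.inRange b)
    with P-rows , _ ∷ r-rows ← Rows-++⁻ P rows
    = dellac (Balanced-↭ (↭-sym (front↭ P r)) b)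
        ((≤-refl , inj₁ (s≤s z≤n)) ∷ Rows-++⁺ P
          (Rows-transfer P-in (λ s s<P _ → RowOK-shift₁⁺ {k} {λs} {a = suc j} (subst (suc s ≤_) P≡k s<P)) P-rows)
          (Rows-transfer r-in (λ s _ _ → RowOK-part {Λ = λs} {ΛU} (parts-beyond P s P≡k)) r-rows))

  dellac-front⁻ : ∀ P {r} → length P ≡ k → Dellac k ΛU (k ∷ P ++ r) → Dellac k λs (P ++ k ∷ r)
  dellac-front⁻ P {r} P≡k (dellac b (_ ∷ rows))
    with _ ∷ Pr-in ← Balanced.inRange b
    with P-in , r-in ← All.++⁻ P Pr-in
    with P-rows , r-rows ← Rows-++⁻ P rows
    = dellac (Balanced-↭ (front↭ P r) b)
        (Rows-++⁺ P (Rows-transfer P-in (λ s s<P _ → RowOK-shift₁⁻ {k} {λs} {a = suc j} (subst (suc s ≤_) P≡k s<P)) P-rows)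
          ((part<k (suc (length P)) , inj₁ (s≤s (≤-reflexive P≡k))) ∷
           Rows-transfer r-in (λ s _ _ → RowOK-part {Λ = ΛU} {λs} (≡.sym (parts-beyond P s P≡k))) r-rows))

  private
    ≤k⇒≤N : ∀ {w} → All (InRange k) w → All (_≤ N) w
    ≤k⇒≤N = All.map λ (_ , c≤k) → m≤n⇒m≤1+n c≤k

    ≤k⇒<N : ∀ {w} → All (InRange k) w → All (_< N) w
    ≤k⇒<N = All.map λ (_ , c≤k) → s≤s c≤k

  inv-NN : ∀ {v} → All (InRange k) v → inv (N ∷ N ∷ v) ≡ inv v
  inv-NN v-in = cong₂ (λ a b → a + (b + _)) (countAbove-none (≤-refl ∷ ≤k⇒≤N v-in)) (countAbove-none (≤k⇒≤N v-in))

  inv-Nk : ∀ P r → All (InRange k) P → All (InRange k) r →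
           inv (N ∷ k ∷ P ++ N ∷ r) ≡ suc (colCount k P) + inv (P ++ k ∷ r)
  inv-Nk P r P-in r-in = begin
    countAbove N (k ∷ P ++ N ∷ r) + inv (k ∷ P ++ N ∷ r)
      ≡⟨ cong (_+ inv (k ∷ P ++ N ∷ r)) (countAbove-none (m≤n⇒m≤1+n ≤-refl ∷ All.++⁺ (≤k⇒≤N P-in) (≤-refl ∷ ≤k⇒≤N r-in))) ⟩
    inv (k ∷ P ++ N ∷ r)
      ≡⟨ inv-extract-max (k ∷ P) r (≤k⇒≤N r-in) ⟩
    countBelow N (k ∷ P) + (countAbove k (P ++ r) + inv (P ++ r))
      ≡⟨ cong₂ (λ a b → a + (b + inv (P ++ r))) (countBelow-all (≤-refl ∷ ≤k⇒<N P-in)) (countAbove-none Pr≤k) ⟩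
    suc (length P) + inv (P ++ r)
      ≡⟨ cong (λ l → suc l + inv (P ++ r)) (countBelow+colCount P (All.map proj₂ P-in)) ⟨
    suc (countBelow k P + colCount k P) + inv (P ++ r)
      ≡⟨ cong suc (rearrange (countBelow k P) (colCount k P) (inv (P ++ r))) ⟩
    suc (colCount k P) + (countBelow k P + inv (P ++ r))
      ≡⟨ cong (suc (colCount k P) +_) (inv-extract-max P r (All.map proj₂ r-in)) ⟨
    suc (colCount k P) + inv (P ++ k ∷ r) ∎
    where
    open ≡.≡-Reasoning
    Pr≤k : All (_≤ k) (P ++ r)
    Pr≤k = All.map proj₂ (All.++⁺ P-in r-in)
    rearrange : ∀ a b c → a + b + c ≡ b + (a + c)
    rearrange a b c = ≡.trans (cong (_+ c) (+-comm a b)) (+-assoc b a c)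

  inv-front : ∀ P r → All (InRange k) P → All (InRange k) r → length P ≡ k → colCount k P ≡ 1 →
              N + inv (k ∷ P ++ r) ≡ 2 + inv (P ++ k ∷ r)
  inv-front P r P-in r-in P≡k one-k = begin
    N + (countAbove k (P ++ r) + inv (P ++ r))
      ≡⟨ cong (λ a → N + (a + inv (P ++ r))) (countAbove-none (All.map proj₂ (All.++⁺ P-in r-in))) ⟩
    suc k + inv (P ++ r)
      ≡⟨ cong (λ l → suc l + inv (P ++ r)) (≡.trans (≡.sym P≡k) (≡.sym (countBelow+colCount P (All.map proj₂ P-in)))) ⟩
    suc (countBelow k P + colCount k P) + inv (P ++ r)
      ≡⟨ cong (λ c → suc (countBelow k P + c) + inv (P ++ r)) one-k ⟩
    suc (countBelow k P + 1) + inv (P ++ r)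
      ≡⟨ cong (λ a → suc a + inv (P ++ r)) (+-comm (countBelow k P) 1) ⟩
    2 + (countBelow k P + inv (P ++ r))
      ≡⟨ cong (2 +_) (inv-extract-max P r (All.map proj₂ r-in)) ⟨
    2 + inv (P ++ k ∷ r) ∎
    where open ≡.≡-Reasoning

  -- In Lx the tag t stands for the factor q^t of [3]_q; in Ly, tag 0 marks configurations of
  -- size n and tag 1 those of size n - 1 with boundary (n-2) ⊕ λ, which carry the factor q^n.
  Tagged : Set
  Tagged = ℕ × List ℕ

  V W U : List (List ℕ)
  V = dellacs k λs
  W = dellacs N ΛW
  U = dellacs k ΛU

  Lx Ly : List Tagged
  Lx = map (0 ,_) V ++ map (1 ,_) V ++ map (2 ,_) V
  Ly = map (0 ,_) W ++ map (1 ,_) U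

  weightX weightY : Tagged → ℕ
  weightX (t , v) = t + inv v
  weightY (zero  , w) = inv w
  weightY (suc _ , u) = N + inv u

  -- Tags outside {0, 1, 2} and words of length < 2 only occur in junk clauses.
  bij : Tagged → Tagged
  bij (0 , v) = 0 , N ∷ N ∷ v
  bij (1 , v) = 0 , N ∷ k ∷ replaceFirst k N v
  bij (2 , v) = if k ≡ᵇ nth v k then (1 , k ∷ deleteAt k v) else (0 , N ∷ k ∷ replaceSecond k N v)
  bij (suc (suc (suc _)) , v) = 0 , v

  bij⁻¹ : Tagged → Tagged
  bij⁻¹ (zero , a ∷ b ∷ w) = if N ≡ᵇ b then (0 , w) else ((if occursBefore N k w then 1 else 2) , replaceAll N k w)
  bij⁻¹ (zero , _)         = 0 , []
  bij⁻¹ (suc _ , u)        = 2 , insertAt k k (drop 1 u)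

  bij⁻¹-NN : ∀ v → bij⁻¹ (0 , N ∷ N ∷ v) ≡ (0 , v)
  bij⁻¹-NN v rewrite ≡ᵇ-refl N = ≡.refl

  bij⁻¹-Nk : ∀ P r → All (N ≢_) P → All (N ≢_) r →
             bij⁻¹ (0 , N ∷ k ∷ P ++ N ∷ r) ≡ ((if occursBefore N k (P ++ N ∷ r) then 1 else 2) , P ++ k ∷ r)
  bij⁻¹-Nk P r N∉P N∉r rewrite ≡ᵇ-≢ {N} {k} (<⇒≢ ≤-refl ∘ ≡.sym) | replaceAll-++ {b = k} P r N∉P N∉r = ≡.refl

  bij⁻¹-front : ∀ P r → length P ≡ k → bij⁻¹ (1 , k ∷ P ++ r) ≡ (2 , P ++ k ∷ r)
  bij⁻¹-front P r P≡k = cong (2 ,_) (insertAt-length-++ P k r P≡k)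

  bij-boundary : ∀ P zs → length P ≡ k → bij (2 , P ++ k ∷ zs) ≡ (1 , k ∷ P ++ zs)
  bij-boundary P zs P≡k
    rewrite nth-length-++ P k zs P≡k | ≡ᵇ-refl k | deleteAt-length-++ P k zs P≡k = ≡.refl

  nth-past-second : ∀ P zs → length P < k → All (k ≢_) zs → k ≢ nth (P ++ k ∷ zs) k
  nth-past-second P zs P<k k∉zs with i , P+i≡k ← m≤n⇒∃[o]m+o≡n P<k =
    subst (λ t → k ≢ nth (P ++ k ∷ zs) t) (≡.trans (+-suc (length P) i) P+i≡k)
      (subst (k ≢_) (≡.sym (nth-++ P (k ∷ zs) (suc i))) ((nth-absent zs i k∉zs λ ()) ∘ ≡.sym))

  bij-interior : ∀ xs ys zs → length (xs ++ k ∷ ys) < k → All (k ≢_) xs → All (k ≢_) ys → All (k ≢_) zs →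
                 bij (2 , (xs ++ k ∷ ys) ++ k ∷ zs) ≡ (0 , N ∷ k ∷ (xs ++ k ∷ ys) ++ N ∷ zs)
  bij-interior xs ys zs P<k k∉xs k∉ys k∉zs
    rewrite ≡ᵇ-≢ (nth-past-second (xs ++ k ∷ ys) zs P<k k∉zs) | ++-assoc xs (k ∷ ys) (k ∷ zs)
          | ++-assoc xs (k ∷ ys) (N ∷ zs) | replaceSecond-++ {b = N} xs ys zs k∉xs k∉ys = ≡.refl

  ∈Lx₀ : ∀ {v} → Dellac k λs v → (0 , v) ∈ Lx
  ∈Lx₀ d = ∈-++⁺ˡ (∈-map⁺ (0 ,_) (∈-dellacs⁺ d))

  ∈Lx₁ : ∀ {v} → Dellac k λs v → (1 , v) ∈ Lx
  ∈Lx₁ d = ∈-++⁺ʳ (map (0 ,_) V) (∈-++⁺ˡ (∈-map⁺ (1 ,_) (∈-dellacs⁺ d)))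

  ∈Lx₂ : ∀ {v} → Dellac k λs v → (2 , v) ∈ Lx
  ∈Lx₂ d = ∈-++⁺ʳ (map (0 ,_) V) (∈-++⁺ʳ (map (1 ,_) V) (∈-map⁺ (2 ,_) (∈-dellacs⁺ d)))

  ∈Ly₀ : ∀ {w} → Dellac N ΛW w → (0 , w) ∈ Ly
  ∈Ly₀ d = ∈-++⁺ˡ (∈-map⁺ (0 ,_) (∈-dellacs⁺ d))

  ∈Ly₁ : ∀ {u} → Dellac k ΛU u → (1 , u) ∈ Ly
  ∈Ly₁ d = ∈-++⁺ʳ (map (0 ,_) W) (∈-map⁺ (1 ,_) (∈-dellacs⁺ d))

  record ColumnK (v : List ℕ) : Set where
    constructor columnK
    field
      xs ys zs : List ℕ
      v≡       : v ≡ xs ++ k ∷ ys ++ k ∷ zs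
      k∉xs     : All (k ≢_) xs
      k∉ys     : All (k ≢_) ys
      k∉zs     : All (k ≢_) zs
      second≤k : length (xs ++ k ∷ ys) ≤ k

  dellac⇒ColumnK : ∀ {v} → Dellac k λs v → ColumnK v
  dellac⇒ColumnK {v} (dellac b rows)
    with xs , r , ≡.refl , k∉xs , one ← colCount≡suc⇒split v (Balanced.columns b k k∈)
    with ys , zs , ≡.refl , k∉ys , none ← colCount≡suc⇒split r one
    with _ , second-ok ∷ _ ← Rows-++⁻ (xs ++ k ∷ ys) (subst (Rows k λs 1) (≡.sym (++-assoc xs (k ∷ ys) (k ∷ zs))) rows)
    = columnK xs ys zs ≡.refl k∉xs k∉ys (colCount≡0⇒absent zs none) (≤-pred (RowOK-last {Λ = λs} second-ok))

  Maps : Tagged → Set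
  Maps x = bij x ∈ Ly × bij⁻¹ (bij x) ≡ x × weightY (bij x) ≡ weightX x

  maps₀ : ∀ {v} → Dellac k λs v → Maps (0 , v)
  maps₀ {v} d = ∈Ly₀ (dellac-NN⁺ d) , bij⁻¹-NN v , inv-NN (Balanced.inRange (Dellac.isBalanced d))

  maps₁ : ∀ {v} → Dellac k λs v → Maps (1 , v)
  maps₁ d with columnK xs ys zs ≡.refl k∉xs _ _ second≤k ← dellac⇒ColumnK d
    with xs-in , _ ∷ R-in ← All.++⁻ xs (Balanced.inRange (Dellac.isBalanced d))
    rewrite replaceFirst-++ {b = N} xs (ys ++ k ∷ zs) k∉xs =
    ∈Ly₀ (dellac-Nk⁺ xs (<-≤-trans (length-< xs ys) second≤k) d) ,
    ≡.trans (bij⁻¹-Nk xs R (N∉ xs-in) (N∉ R-in))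
            (cong (λ b → (if b then 1 else 2) , xs ++ k ∷ R) (occursBefore-first xs R (All.zip (N∉ xs-in , k∉xs)))) ,
    ≡.trans (inv-Nk xs R xs-in R-in) (cong (λ c → suc c + inv (xs ++ k ∷ R)) (colCount-absent xs k∉xs))
    where R = ys ++ k ∷ zs

  maps-boundary : ∀ P zs → length P ≡ k → colCount k P ≡ 1 → Dellac k λs (P ++ k ∷ zs) → Maps (2 , P ++ k ∷ zs)
  maps-boundary P zs P≡k one-k d with P-in , _ ∷ zs-in ← All.++⁻ P (Balanced.inRange (Dellac.isBalanced d)) =
    subst (λ y → y ∈ Ly × bij⁻¹ y ≡ (2 , P ++ k ∷ zs) × weightY y ≡ 2 + inv (P ++ k ∷ zs))
      (≡.sym (bij-boundary P zs P≡k))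
      (∈Ly₁ (dellac-front⁺ P P≡k d) , bij⁻¹-front P zs P≡k , inv-front P zs P-in zs-in P≡k one-k)

  maps-interior : ∀ xs ys zs → length (xs ++ k ∷ ys) < k → All (k ≢_) xs → All (k ≢_) ys → All (k ≢_) zs →
                  Dellac k λs ((xs ++ k ∷ ys) ++ k ∷ zs) → Maps (2 , (xs ++ k ∷ ys) ++ k ∷ zs)
  maps-interior xs ys zs P<k k∉xs k∉ys k∉zs d
    with P-in , _ ∷ zs-in ← All.++⁻ (xs ++ k ∷ ys) (Balanced.inRange (Dellac.isBalanced d))
    with xs-in , _ ← All.++⁻ xs P-in =
    subst (λ y → y ∈ Ly × bij⁻¹ y ≡ (2 , P ++ k ∷ zs) × weightY y ≡ 2 + inv (P ++ k ∷ zs))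
      (≡.sym (bij-interior xs ys zs P<k k∉xs k∉ys k∉zs))
      (∈Ly₀ (dellac-Nk⁺ P P<k d) ,
       ≡.trans (bij⁻¹-Nk P zs (N∉ P-in) (N∉ zs-in)) (cong (λ b → (if b then 1 else 2) , P ++ k ∷ zs) k-first) ,
       ≡.trans (inv-Nk P zs P-in zs-in) (cong (λ c → suc c + inv (P ++ k ∷ zs)) (colCount-single xs ys k∉xs k∉ys)))
    where
    P = xs ++ k ∷ ys
    k-first : occursBefore N k (P ++ N ∷ zs) ≡ false
    k-first = ≡.trans (cong (occursBefore N k) (++-assoc xs (k ∷ ys) (N ∷ zs)))
      (occursBefore-second xs (ys ++ N ∷ zs) (<⇒≢ ≤-refl ∘ ≡.sym) (All.zip (N∉ xs-in , k∉xs)))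

  maps₂ : ∀ {v} → Dellac k λs v → Maps (2 , v)
  maps₂ d with columnK xs ys zs ≡.refl k∉xs k∉ys k∉zs second≤k ← dellac⇒ColumnK d
    rewrite ≡.sym (++-assoc xs (k ∷ ys) (k ∷ zs))
    with length (xs ++ k ∷ ys) ≟ k
  ... | yes P≡k = maps-boundary (xs ++ k ∷ ys) zs P≡k (colCount-single xs ys k∉xs k∉ys) d
  ... | no  P≢k = maps-interior xs ys zs (≤∧≢⇒< second≤k P≢k) k∉xs k∉ys k∉zs d

  Reached : Tagged → Set
  Reached y = ∃ λ x → x ∈ Lx × bij x ≡ y

  private
    split-two : ∀ a b → a + suc b ≡ 2 → (a ≡ 0 × b ≡ 1) ⊎ (a ≡ 1 × b ≡ 0)
    split-two zero          b       e = inj₁ (≡.refl , suc-injective e)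
    split-two (suc zero)    zero    _ = inj₂ (≡.refl , ≡.refl)
    split-two (suc zero)    (suc _) ()
    split-two (suc (suc a)) b       e with () ← ≡.trans (≡.sym (+-suc a b)) (suc-injective (suc-injective e))

    one-more-N : ∀ {w} → Balanced N (N ∷ k ∷ w) → colCount N w ≡ 1
    one-more-N {w} b = suc-injective (≡.trans
      (≡.sym (≡.trans (colCount-here N (k ∷ w)) (cong suc (colCount-there w (<⇒≢ ≤-refl ∘ ≡.sym)))))
      (Balanced.columns b N (s≤s z≤n , ≤-refl)))

  onto-Nk : ∀ {w} → Dellac N ΛW (N ∷ k ∷ w) → Reached (0 , N ∷ k ∷ w)
  onto-Nk {w} d@(dellac b (_ ∷ _ ∷ rows))
    with P , r , ≡.refl , _ , _ ← colCount≡suc⇒split w (one-more-N b)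
    with _ , N-ok ∷ _ ← Rows-++⁻ P rows
    with P<k ← ≤-pred (≤-pred (RowOK-last {Λ = ΛW} N-ok))
    with dv ← dellac-Nk⁻ P P<k d
    with split-two (colCount k P) (colCount k r)
           (≡.trans (≡.sym (≡.trans (colCount-++ k P (k ∷ r)) (cong (colCount k P +_) (colCount-here k r))))
                    (Balanced.columns (Dellac.isBalanced dv) k k∈))
  ... | inj₁ (none-in-P , _) =
    (1 , P ++ k ∷ r) , ∈Lx₁ dv , cong (λ v → 0 , N ∷ k ∷ v) (replaceFirst-++ P r (colCount≡0⇒absent P none-in-P))
  ... | inj₂ (one-in-P , none-in-r)
    with xs , ys , ≡.refl , k∉xs , none-in-ys ← colCount≡suc⇒split P one-in-P =
    (2 , (xs ++ k ∷ ys) ++ k ∷ r) , ∈Lx₂ dv ,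
    bij-interior xs ys r P<k k∉xs (colCount≡0⇒absent ys none-in-ys) (colCount≡0⇒absent r none-in-r)

  onto-W : ∀ {w} → Dellac N ΛW w → Reached (0 , w)
  onto-W {a ∷ b ∷ w} d@(dellac (balanced _ ((_ , a≤N) ∷ (_ , b≤N) ∷ _) _) ((k<a , _) ∷ (k-1<b , _) ∷ _))
    with ≡.refl ← ≤-antisym a≤N k<a
    with m≤n⇒m<n∨m≡n b≤N
  ... | inj₂ ≡.refl = (0 , w) , ∈Lx₀ (dellac-NN⁻ d) , ≡.refl
  ... | inj₁ (s≤s b≤k) with ≡.refl ← ≤-antisym b≤k k-1<b = onto-Nk d

  onto-U : ∀ {u} → Dellac k ΛU u → Reached (1 , u)
  onto-U {a ∷ u} d@(dellac (balanced len ((_ , a≤k) ∷ _) _) ((k-1<a , _) ∷ _))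
    with ≡.refl ← ≤-antisym a≤k k-1<a =
    (2 , P ++ k ∷ zs) , ∈Lx₂ (dellac-front⁻ P P≡k (subst (λ v → Dellac k ΛU (k ∷ v)) (≡.sym (take++drop≡id k u)) d)) ,
    ≡.trans (bij-boundary P zs P≡k) (cong (λ v → 1 , k ∷ v) (take++drop≡id k u))
    where
    P = take k u
    zs = drop k u
    P≡k : length P ≡ k
    P≡k = ≡.trans (length-take k u) (m≤n⇒m⊓n≡m (half≤ (length u) (suc j) len))

  maps : ∀ {x} → x ∈ Lx → Maps x
  maps x∈ with ∈-++⁻ (map (0 ,_) V) x∈
  ... | inj₁ x∈₀ with _ , v∈ , ≡.refl ← ∈-map⁻ (0 ,_) x∈₀ = maps₀ (∈-dellacs⁻ v∈)
  ... | inj₂ x∈₁₂ with ∈-++⁻ (map (1 ,_) V) x∈₁₂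
  ...   | inj₁ x∈₁ with _ , v∈ , ≡.refl ← ∈-map⁻ (1 ,_) x∈₁ = maps₁ (∈-dellacs⁻ v∈)
  ...   | inj₂ x∈₂ with _ , v∈ , ≡.refl ← ∈-map⁻ (2 ,_) x∈₂ = maps₂ (∈-dellacs⁻ v∈)

  reached : ∀ {y} → y ∈ Ly → Reached y
  reached y∈ with ∈-++⁻ (map (0 ,_) W) y∈
  ... | inj₁ y∈₀ with _ , w∈ , ≡.refl ← ∈-map⁻ (0 ,_) y∈₀ = onto-W (∈-dellacs⁻ w∈)
  ... | inj₂ y∈₁ with _ , u∈ , ≡.refl ← ∈-map⁻ (1 ,_) y∈₁ = onto-U (∈-dellacs⁻ u∈)

  Lx-unique : Unique Lx
  Lx-unique = Unique.++⁺ (tagged-unique 0 (dellacs-unique k λs))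
    (Unique.++⁺ (tagged-unique 1 (dellacs-unique k λs)) (tagged-unique 2 (dellacs-unique k λs))
      (tagged-disjoint (All.map⁺ (All.universal (λ _ ()) V))))
    (tagged-disjoint (All.++⁺ (All.map⁺ (All.universal (λ _ ()) V)) (All.map⁺ (All.universal (λ _ ()) V))))

  Ly-unique : Unique Ly
  Ly-unique = Unique.++⁺ (tagged-unique 0 (dellacs-unique N ΛW)) (tagged-unique 1 (dellacs-unique k ΛU))
    (tagged-disjoint (All.map⁺ (All.universal (λ _ ()) U)))

  gf-Ly≋gf-Lx : gf weightY Ly ≋ gf weightX Lx
  gf-Ly≋gf-Lx = ≋-trans
    (gf-bijection weightY bij bij⁻¹ Lx-unique Ly-unique (λ x∈ → let y∈ , inverse , _ = maps x∈ in y∈ , inverse) reached)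
    (≡⇒≋ (gf-cong (tabulate λ x∈ → let _ , _ , weight = maps x∈ in weight)))

  gf-Lx : gf weightX Lx ≋ frakC k λs ⊕ (shift 1 (frakC k λs) ⊕ shift 2 (frakC k λs))
  gf-Lx = begin
    gf weightX Lx
      ≈⟨ ≋-trans (gf-++ weightX (map (0 ,_) V) _) (⊕-cong ≋-refl (gf-++ weightX (map (1 ,_) V) _)) ⟩
    gf weightX (map (0 ,_) V) ⊕ (gf weightX (map (1 ,_) V) ⊕ gf weightX (map (2 ,_) V))
      ≈⟨ ⊕-cong (≡⇒≋ (gf-map weightX (0 ,_) V)) (⊕-cong (copy 1) (copy 2)) ⟩
    frakC k λs ⊕ (shift 1 (frakC k λs) ⊕ shift 2 (frakC k λs)) ∎
    where
    open SetoidReasoning ≋-setoid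
    copy : ∀ t → gf weightX (map (t ,_) V) ≋ shift t (frakC k λs)
    copy t = ≋-trans (≡⇒≋ (gf-map weightX (t ,_) V)) (gf-shift t inv _ (λ _ → ≡.refl) V)

  gf-Ly : gf weightY Ly ≋ frakC N ΛW ⊕ shift N (frakC k ΛU)
  gf-Ly = ≋-trans (gf-++ weightY (map (0 ,_) W) _)
    (⊕-cong (≡⇒≋ (gf-map weightY (0 ,_) W))
            (≋-trans (≡⇒≋ (gf-map weightY (1 ,_) U)) (gf-shift N inv _ (λ _ → ≡.refl) U)))

  identity : frakC N ΛW ⊕ shift N (frakC k ΛU) ≋ q3 ⊗ frakC k λs
  identity = begin
    frakC N ΛW ⊕ shift N (frakC k ΛU)                           ≈⟨ gf-Ly ⟨
    gf weightY Ly                                               ≈⟨ gf-Ly≋gf-Lx ⟩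
    gf weightX Lx                                               ≈⟨ gf-Lx ⟩
    frakC k λs ⊕ (shift 1 (frakC k λs) ⊕ shift 2 (frakC k λs))  ≈⟨ q3-⊗ (frakC k λs) ⟨
    q3 ⊗ frakC k λs                                             ∎
    where open SetoidReasoning ≋-setoid

lemma7p11 : (n : ℕ) → 3 ≤ n → (λs : List ℕ) → IsPartition λs
    → part λs 1 ≤ n ∸ 3
    → length λs ≤ n ∸ 1
    → (∀ m → 1 ≤ m → mult m λs ≤ 2)
    → (frakC n ((n ∸ 1) ∷ (n ∸ 2) ∷ λs) ⊕ shift n (frakC (n ∸ 1) ((n ∸ 2) ∷ λs)))
      ≈ₚ (q3 ⊗ frakC (n ∸ 1) λs)
lemma7p11 1 (s≤s ()) _ _ _ _ _
lemma7p11 2 (s≤s (s≤s ())) _ _ _ _ _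
lemma7p11 (suc (suc (suc j))) _ λs λ-partition λ₁≤j length≤ _ =
  coeff-≡ (Decomposition.identity j λs part≤j length≤)
  where
  part≤j : ∀ t → part λs t ≤ j
  part≤j t = ≤-trans (part≤head λs (IsPartition.decreasing λ-partition) t) λ₁≤j
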